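{- Let $N$ be a quotient of a matroid $M$ such that $M$ and $N$ have a common basis. If $N$ is finitary or $M$ is cofinitary, then $M=N$.
   Context: Matroids are possibly infinite (in the sense of Bruhn, Diestel, Kriesell, Pendavingh and Wollan). A matroid is finitary if all its circuits are finite, and cofinitary if its dual is finitary. For matroids $M,N$ on the same ground set $E$, $N$ is a quotient of $M$ if $\mathrm{cl}_M(X)\subseteq\mathrm{cl}_N(X)$ for all $X\subseteq E$. -}

module Defs where

open import Level using (0ℓ; Level; _⊔_)
open import Data.Product using (Σ; ∃; _×_; _,_)
open import Data.Sum using (_⊎_)
open import Data.List using (List)
open import Data.List.Membership.Propositional using (_∈_)
open import Relation.Nullary using (¬_)
open import Relation.Unary using (Pred; _⊆_)
open import Relation.Binary.PropositionalEquality using (_≡_)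

Subset : Set → Set₁
Subset E = Pred E 0ℓ

∅ : {E : Set} → Subset E
∅ _ = Data.Empty.⊥
  where import Data.Empty

_+ₛ_ : {E : Set} → Subset E → E → Subset E
(X +ₛ x) y = X y ⊎ y ≡ x

Finite : {E : Set} → Subset E → Set
Finite {E} X = Σ (List E) λ xs → ∀ x → X x → x ∈ xs

Maximal : {ℓ : Level} {E : Set} → (Subset E → Set ℓ) → Subset E → Set (Level.suc 0ℓ ⊔ ℓ)
Maximal P B = P B × (∀ I → P I → B ⊆ I → I ⊆ B)

Minimal : {ℓ : Level} {E : Set} → (Subset E → Set ℓ) → Subset E → Set (Level.suc 0ℓ ⊔ ℓ)
Minimal P C = P C × (∀ D → P D → D ⊆ C → C ⊆ D)

-- (Possibly infinite) matroid on ground set E, via the independence axioms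
-- of Bruhn, Diestel, Kriesell, Pendavingh and Wollan: (I1), (I2), (I3), (IM).
record Matroid (E : Set) : Set₁ where
  field
    Indep : Subset E → Set
    indep-∅ : Indep ∅
    indep-⊆ : (I J : Subset E) → Indep J → I ⊆ J → Indep I
    indep-aug : (I I' : Subset E) → Indep I → ¬ Maximal Indep I → Maximal Indep I' →
                Σ E λ x → I' x × ¬ I x × Indep (I +ₛ x)
    indep-max : (I X : Subset E) → Indep I → I ⊆ X →
                Σ (Subset E) λ J → Maximal (λ J' → Indep J' × I ⊆ J' × J' ⊆ X) J

module _ {E : Set} (M : Matroid E) where
  open Matroid M

  Base : Subset E → Set₁
  Base = Maximal Indep

  Circuit : Subset E → Set₁
  Circuit = Minimal (λ C → ¬ Indep C)

  cl : Subset E → Pred E (Level.suc 0ℓ)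
  cl X x = X x ⊎ Σ (Subset E) λ C → Circuit C × C x × C ⊆ (X +ₛ x)

  -- Dual matroid M*: independent sets are the sets disjoint from some base of M.
  CoIndep : Subset E → Set₁
  CoIndep I = Σ (Subset E) λ B → Base B × (∀ x → I x → ¬ B x)

  CoCircuit : Subset E → Set₁
  CoCircuit = Minimal (λ C → ¬ CoIndep C)

  Finitary : Set₁
  Finitary = ∀ C → Circuit C → Finite C

  -- M is cofinitary iff M* is finitary
  Cofinitary : Set₁
  Cofinitary = ∀ C → CoCircuit C → Finite C

IsQuotient : {E : Set} → (N M : Matroid E) → Set₁
IsQuotient N M = ∀ X → cl M X ⊆ cl N X

-- M = N: same independent sets (sets are compared extensionally).
SameMatroid : {E : Set} → (M N : Matroid E) → Set₁
SameMatroid M N = ∀ I → (Matroid.Indep M I → Matroid.Indep N I) × (Matroid.Indep N I → Matroid.Indep M I)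

{-# OPTIONS --safe #-}
-- If Q is a common base, the quotient property makes an exchange Q - b + e an M-base exactly when it
-- is an N-base: b lies in its M-closure, hence in its N-closure, and the N-circuit witnessing this is
-- the fundamental N-circuit of e in Q, so it contains b and Q + e - b is N-independent. Bases at
-- finite distance are joined by finitely many exchanges, so an M-base K with K ∖ B finite is an
-- N-base, and an N-base J with B ∖ J finite is an M-base. If N is finitary, a finite N-circuit C in
-- an M-independent set extends to an M-base K ⊆ C ∪ B, which is then an N-base containing C. If M is cofinitary and an N-base L lies in an M-base K ≠ L,
-- the fundamental M-cocircuit D of some e ∈ K ∖ L is finite and avoids L; a maximal N-independent
-- J ⊆ E ∖ D containing B ∖ D is then an N-base with B ∖ J ⊆ D, hence an M-base avoiding the
-- cocircuit D. So N-bases are M-bases; since a maximal N-independent subset of an M-base is an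
-- N-base, it is that whole M-base, and M-independent sets are N-independent.
module Submission where

open import Level using (0ℓ; Level; lift; lower)
open import Data.Empty using (⊥-elim)
open import Data.Unit using (tt)
open import Data.Product using (Σ; _×_; _,_; proj₁; proj₂)
open import Data.Sum using (_⊎_; inj₁; inj₂; [_,_])
open import Data.List using (List; []; _∷_)
open import Data.List.Relation.Unary.Any using (here; there)
open import Data.List.Relation.Unary.Any.Properties using (¬Any[])
open import Data.List.Membership.Propositional using (_∈_)
open import Function.Bundles using (_⇔_; mk⇔; Equivalence)
open import Function.Construct.Composition using (_⇔-∘_)
open import Relation.Nullary using (¬_; Dec; yes; no)
open import Relation.Nullary.Decidable using (map′; decidable-stable)
open import Relation.Unary using (_⊆_; _≐_; _∪_; _∩_; _∖_; ∁; U)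
open import Relation.Unary.Properties using (≐-sym)
open import Relation.Binary.PropositionalEquality using (_≡_; refl)
open import Axiom.ExcludedMiddle using (ExcludedMiddle)
open import Axiom.DoubleNegationElimination using (em⇒dne)

open import Defs

_-ₛ_ : {E : Set} → Subset E → E → Subset E
(X -ₛ e) y = X y × ¬ y ≡ e

module _ {E : Set} where
  private variable
    X Y Z : Subset E
    e x : E

  +ₛ-⊆ : X ⊆ Y → Y x → X +ₛ x ⊆ Y
  +ₛ-⊆ X⊆Y Yx (inj₁ Xz) = X⊆Y Xz
  +ₛ-⊆ X⊆Y Yx (inj₂ refl) = Yx

  ⊆∪⇒∖⊆ : X ⊆ Y ∪ Z → X ∖ Z ⊆ Y
  ⊆∪⇒∖⊆ X⊆Y∪Z (Xx , ¬Zx) with X⊆Y∪Z Xx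
  ... | inj₁ Yx = Yx
  ... | inj₂ Zx = ⊥-elim (¬Zx Zx)

  ⊆+⇒-⊆ : X ⊆ Y +ₛ x → X -ₛ x ⊆ Y
  ⊆+⇒-⊆ X⊆Y+x (Xz , z≢x) with X⊆Y+x Xz
  ... | inj₁ Yz = Yz
  ... | inj₂ z≡x = ⊥-elim (z≢x z≡x)

  exchange-+-⊆ : X x → ((X -ₛ x) +ₛ e) +ₛ x ⊆ X +ₛ e
  exchange-+-⊆ _ (inj₁ (inj₁ (Xz , _))) = inj₁ Xz
  exchange-+-⊆ _ (inj₁ (inj₂ z≡e)) = inj₂ z≡e
  exchange-+-⊆ Xx (inj₂ refl) = inj₁ Xx

  finite-⊆ : X ⊆ Y → Finite Y → Finite X
  finite-⊆ X⊆Y (xs , cover) = xs , λ x Xx → cover x (X⊆Y Xx)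

module Classical (em : ExcludedMiddle (Level.suc 0ℓ)) where

  dec : (P : Set) → Dec P
  dec P = map′ lower lift em

  dne : {P : Set} → ¬ ¬ P → P
  dne = decidable-stable (dec _)

  dne₁ : {P : Set₁} → ¬ ¬ P → P
  dne₁ = em⇒dne em

  module _ {E : Set} where
    private variable
      X Y Z C : Subset E
      b e : E

    ⊈⇒∃ : ¬ (X ⊆ Y) → Σ E λ x → X x × ¬ Y x
    ⊈⇒∃ X⊈Y = dne λ ∄ → X⊈Y λ {x} Xx → dne λ ¬Yx → ∄ (x , Xx , ¬Yx)

    ∖-⊆-swap : X ∖ Y ⊆ Z → X ∖ Z ⊆ Y
    ∖-⊆-swap X∖Y⊆Z (Xx , ¬Zx) = dne λ ¬Yx → ¬Zx (X∖Y⊆Z (Xx , ¬Yx))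

    ⊆-+- : X ⊆ (X -ₛ b) +ₛ b
    ⊆-+- {b = b} {x = z} Xz with dec (z ≡ b)
    ... | yes z≡b = inj₂ z≡b
    ... | no z≢b = inj₁ (Xz , z≢b)

    -⊆⇒⊆+ : X -ₛ b ⊆ Y → X ⊆ Y +ₛ b
    -⊆⇒⊆+ {X = X} X-b⊆Y Xz with ⊆-+- {X = X} Xz
    ... | inj₁ X-b-z = inj₁ (X-b⊆Y X-b-z)
    ... | inj₂ z≡b = inj₂ z≡b

    exchange-inverse : X b → ¬ X e → (((X -ₛ b) +ₛ e) -ₛ e) +ₛ b ≐ X
    exchange-inverse {X} {b} {e} Xb ¬Xe = to , from
      where
        to : (((X -ₛ b) +ₛ e) -ₛ e) +ₛ b ⊆ X
        to (inj₁ (inj₁ (Xz , _) , _)) = Xz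
        to (inj₁ (inj₂ z≡e , z≢e)) = ⊥-elim (z≢e z≡e)
        to (inj₂ refl) = Xb
        from : X ⊆ (((X -ₛ b) +ₛ e) -ₛ e) +ₛ b
        from Xz with ⊆-+- {X = X} {b = b} Xz
        ... | inj₂ z≡b = inj₂ z≡b
        ... | inj₁ X-b-z = inj₁ (inj₁ X-b-z , λ { refl → ¬Xe Xz })

    minimal-by-deletions : {ℓ : Level} {P : Subset E → Set ℓ} →
                           (∀ {I J} → P J → I ⊆ J → P I) → ¬ P C → (∀ {z} → C z → P (C -ₛ z)) →
                           Minimal (λ D → ¬ P D) C
    minimal-by-deletions P-⊆ ¬PC P-deletion = ¬PC , λ D ¬PD D⊆C {z} Cz →
      dne λ ¬Dz → ¬PD (P-⊆ (P-deletion Cz) λ Dw → D⊆C Dw , λ { refl → ¬Dz Dw })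

module MatroidTheory (em : ExcludedMiddle (Level.suc 0ℓ)) {E : Set} (X : Matroid E) where
  open Classical em
  open Matroid X public

  private variable
    I J K L P Q Y C : Subset E
    b e x y : E

  MaxIndepIn : Subset E → Subset E → Set₁
  MaxIndepIn Y = Maximal (λ J → Indep J × J ⊆ Y)

  extend-to-maxIndepIn : Indep I → I ⊆ Y → Σ (Subset E) λ J → I ⊆ J × MaxIndepIn Y J
  extend-to-maxIndepIn {I} {Y} iI I⊆Y
    with J , (iJ , I⊆J , J⊆Y) , maxJ ← indep-max I Y iI I⊆Y
    = J , I⊆J , (iJ , J⊆Y) , λ J' (iJ' , J'⊆Y) J⊆J' →
        maxJ J' (iJ' , (λ Iz → J⊆J' (I⊆J Iz)) , J'⊆Y) J⊆J'

  maxIndepIn-exists : (Y : Subset E) → Σ (Subset E) (MaxIndepIn Y)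
  maxIndepIn-exists Y with J , _ , maxJ ← extend-to-maxIndepIn {Y = Y} indep-∅ (λ ()) = J , maxJ

  maxIndepIn-+-dependent : MaxIndepIn Y J → Y x → ¬ J x → ¬ Indep (J +ₛ x)
  maxIndepIn-+-dependent ((_ , J⊆Y) , maxJ) Yx ¬Jx iJ+x = ¬Jx (maxJ _ (iJ+x , +ₛ-⊆ J⊆Y Yx) inj₁ (inj₂ refl))

  maxIndepIn-dependent : MaxIndepIn Y J → ¬ Indep Y → Σ E λ x → Y x × ¬ J x × ¬ Indep (J +ₛ x)
  maxIndepIn-dependent maxJ@((iJ , _) , _) ¬iY
    with x , Yx , ¬Jx ← ⊈⇒∃ (λ Y⊆J → ¬iY (indep-⊆ _ _ iJ Y⊆J))
    = x , Yx , ¬Jx , maxIndepIn-+-dependent maxJ Yx ¬Jx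

  maxIndepIn-+ : MaxIndepIn Y J → ¬ Indep (J +ₛ b) → MaxIndepIn (Y +ₛ b) J
  maxIndepIn-+ {Y} {J} {b} ((iJ , J⊆Y) , maxJ) dep =
    (iJ , λ Jz → inj₁ (J⊆Y Jz)) , λ J' (iJ' , J'⊆Y+b) J⊆J' → maxJ J' (iJ' , ⊆Y iJ' J'⊆Y+b J⊆J') J⊆J'
    where
      ⊆Y : ∀ {J'} → Indep J' → J' ⊆ Y +ₛ b → J ⊆ J' → J' ⊆ Y
      ⊆Y iJ' J'⊆Y+b J⊆J' J'z with J'⊆Y+b J'z
      ... | inj₁ Yz = Yz
      ... | inj₂ refl = ⊥-elim (dep (indep-⊆ _ _ iJ' (+ₛ-⊆ J⊆J' J'z)))

  spanning-maxIndepIn⇒base : Base X L → L ⊆ Y → MaxIndepIn Y J → Base X J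
  spanning-maxIndepIn⇒base {L = L} {J = J} bL L⊆Y maxJ@((iJ , _) , _) = dne₁ λ ¬bJ →
    let z , Lz , ¬Jz , iJ+z = indep-aug J L iJ ¬bJ bL
    in maxIndepIn-+-dependent maxJ (L⊆Y Lz) ¬Jz iJ+z

  base-+-dependent : Base X P → ¬ P x → ¬ Indep (P +ₛ x)
  base-+-dependent (_ , maxP) ¬Px iP+x = ¬Px (maxP _ iP+x inj₁ (inj₂ refl))

  base-respects-≐ : Base X P → P ≐ Q → Base X Q
  base-respects-≐ (iP , maxP) (P⊆Q , Q⊆P) =
    indep-⊆ _ _ iP Q⊆P , λ I iI Q⊆I Iz → P⊆Q (maxP I iI (λ Pw → Q⊆I (P⊆Q Pw)) Iz)

  base-minus-not-base : Base X P → P b → ¬ Base X (P -ₛ b)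
  base-minus-not-base (iP , _) Pb (_ , maxP-b) = proj₂ (maxP-b _ iP proj₁ Pb) refl

  base-exists : Σ (Subset E) (Base X)
  base-exists with J , (iJ , _) , maxJ ← maxIndepIn-exists U = J , iJ , λ I iI J⊆I → maxJ I (iI , λ _ → tt) J⊆I

  extend-to-base-within : Indep I → Base X P → Σ (Subset E) λ Q → Base X Q × I ⊆ Q × Q ⊆ I ∪ P
  extend-to-base-within iI bP with Q , I⊆Q , maxQ@((_ , Q⊆I∪P) , _) ← extend-to-maxIndepIn iI inj₁ =
    Q , spanning-maxIndepIn⇒base bP inj₂ maxQ , I⊆Q , Q⊆I∪P

  exchange-preserves-base : Base X P → P b → ¬ (P -ₛ b) e → Indep ((P -ₛ b) +ₛ e) → Base X ((P -ₛ b) +ₛ e)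
  exchange-preserves-base {P} {b} {e} bP Pb ¬P-b-e iP'
    with Q , bQ , P'⊆Q , Q⊆P'∪P ← extend-to-base-within iP' bP
    = base-respects-≐ bQ (Q⊆P' , P'⊆Q)
    where
      Q⊆P' : Q ⊆ (P -ₛ b) +ₛ e
      Q⊆P' {z} Qz with Q⊆P'∪P Qz | dec (z ≡ b) | dec (z ≡ e)
      ... | inj₁ P'z | _ | _ = P'z
      ... | inj₂ Pz | no z≢b | _ = inj₁ (Pz , z≢b)
      ... | inj₂ _ | yes _ | yes z≡e = inj₂ z≡e
      ... | inj₂ _ | yes refl | no z≢e = ⊥-elim (¬P-b-e (Q⊆P (P'⊆Q (inj₂ refl)) , λ { refl → z≢e refl }))
        where
          Q⊆P : Q ⊆ P
          Q⊆P = proj₂ bP Q (proj₁ bQ) λ Pw → +ₛ-⊆ (λ P-b-w → P'⊆Q (inj₁ P-b-w)) Qz (⊆-+- {X = P} Pw)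

  base-exchange : Base X P → Base X K → P y → ¬ K y → Σ E λ b → K b × ¬ P b × Base X ((P -ₛ y) +ₛ b)
  base-exchange {P} {K} {y} bP bK Py ¬Ky
    with b , Kb , ¬P-y-b , iP' ←
           indep-aug (P -ₛ y) K (indep-⊆ _ P (proj₁ bP) proj₁) (base-minus-not-base bP Py) bK
    = b , Kb , (λ Pb → ¬P-y-b (Pb , λ { refl → ¬Ky Kb })) , exchange-preserves-base bP Py ¬P-y-b iP'

  extend-maxIndepIn-to-base : MaxIndepIn Y J → Base X K →
                              Σ (Subset E) λ L → Base X L × J ⊆ L × L ⊆ J ∪ (K ∖ Y)
  extend-maxIndepIn-to-base {Y} {J} {K} ((iJ , J⊆Y) , maxJ) bK
    with L , J⊆L , maxL@((iL , L⊆J∪K∖Y) , _) ← extend-to-maxIndepIn iJ inj₁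
    = L , dne₁ (λ ¬bL → no-augmentation (indep-aug L K iL ¬bL bK)) , J⊆L , L⊆J∪K∖Y
    where
      no-augmentation : ¬ Σ E (λ z → K z × ¬ L z × Indep (L +ₛ z))
      no-augmentation (z , Kz , ¬Lz , iL+z) with dec (Y z)
      ... | no ¬Yz = maxIndepIn-+-dependent maxL (inj₂ (Kz , ¬Yz)) ¬Lz iL+z
      ... | yes Yz = ¬Lz (J⊆L (maxJ ((L +ₛ z) ∩ Y) (indep-⊆ _ _ iL+z proj₁ , proj₂)
                                     (λ Jw → inj₁ (J⊆L Jw) , J⊆Y Jw) (inj₂ refl , Yz)))

  -- Extend J to a base B₁ meeting Y only in J. If no element of J augments I, a base J₂ with
  -- I ⊆ J₂ ⊆ I ∪ B₁ meets Y only in I. For a base K with I + y ⊆ K ⊆ (I + y) ∪ J₂, extending J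
  -- inside J ∪ (K ∖ Y) gives a base contained in, hence equal to, B₁; this forces J₂ ⊆ K, so
  -- K = J₂ and y ∈ J₂ ∩ Y ⊆ I.
  restriction-augment : MaxIndepIn Y J → Indep I → I ⊆ Y → Y y → ¬ I y → Indep (I +ₛ y) →
                        Σ E λ z → J z × ¬ I z × Indep (I +ₛ z)
  restriction-augment {Y} {J} {I} {y} maxJ@((_ , J⊆Y) , _) iI I⊆Y Yy ¬Iy iI+y = dne ¬¬augmentation
    where
      ¬¬augmentation : ¬ ¬ Σ E (λ z → J z × ¬ I z × Indep (I +ₛ z))
      ¬¬augmentation noAug
        with B₁ , bB₁ , J⊆B₁ , B₁⊆J∪B₀∖Y ← extend-maxIndepIn-to-base maxJ (proj₂ base-exists)
        with J₂ , bJ₂ , I⊆J₂ , J₂⊆I∪B₁ ← extend-to-base-within iI bB₁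
        with K , bK , I+y⊆K , K⊆I+y∪J₂ ← extend-to-base-within iI+y bJ₂
        with L , bL , J⊆L , L⊆J∪K∖Y ← extend-maxIndepIn-to-base maxJ bK
        = ¬Iy (J₂∩Y⊆I (K⊆J₂ (I+y⊆K (inj₂ refl))) Yy)
        where
          J₂∩Y⊆I : ∀ {w} → J₂ w → Y w → I w
          J₂∩Y⊆I {w} J₂w Yw =
            dne λ ¬Iw → noAug (w , J∋w ¬Iw , ¬Iw , indep-⊆ _ J₂ (proj₁ bJ₂) (+ₛ-⊆ I⊆J₂ J₂w))
            where
              J∋w : ¬ I w → J w
              J∋w ¬Iw with J₂⊆I∪B₁ J₂w
              ... | inj₁ Iw = ⊥-elim (¬Iw Iw)
              ... | inj₂ B₁w with B₁⊆J∪B₀∖Y B₁w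
              ...   | inj₁ Jw = Jw
              ...   | inj₂ (_ , ¬Yw) = ⊥-elim (¬Yw Yw)
          J₂∖Y⊆B₁ : ∀ {w} → J₂ w → ¬ Y w → B₁ w
          J₂∖Y⊆B₁ J₂w ¬Yw with J₂⊆I∪B₁ J₂w
          ... | inj₁ Iw = ⊥-elim (¬Yw (I⊆Y Iw))
          ... | inj₂ B₁w = B₁w
          L⊆B₁ : L ⊆ B₁
          L⊆B₁ Lw with L⊆J∪K∖Y Lw
          ... | inj₁ Jw = J⊆B₁ Jw
          ... | inj₂ (Kw , ¬Yw) with K⊆I+y∪J₂ Kw
          ...   | inj₁ I+y∋w = ⊥-elim (¬Yw (+ₛ-⊆ I⊆Y Yy I+y∋w))
          ...   | inj₂ J₂w = J₂∖Y⊆B₁ J₂w ¬Yw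
          J₂⊆K : J₂ ⊆ K
          J₂⊆K {w} J₂w with dec (Y w)
          ... | yes Yw = I+y⊆K (inj₁ (J₂∩Y⊆I J₂w Yw))
          ... | no ¬Yw with L⊆J∪K∖Y (proj₂ bL B₁ (proj₁ bB₁) L⊆B₁ (J₂∖Y⊆B₁ J₂w ¬Yw))
          ...   | inj₁ Jw = ⊥-elim (¬Yw (J⊆Y Jw))
          ...   | inj₂ (Kw , _) = Kw
          K⊆J₂ : K ⊆ J₂
          K⊆J₂ = proj₂ bJ₂ K (proj₁ bK) J₂⊆K

  fundamentalCircuit : Subset E → E → Subset E
  fundamentalCircuit I x z = z ≡ x ⊎ (I z × Indep ((I -ₛ z) +ₛ x))

  fundamentalCircuit-⊆ : fundamentalCircuit I x ⊆ I +ₛ x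
  fundamentalCircuit-⊆ (inj₁ z≡x) = inj₂ z≡x
  fundamentalCircuit-⊆ (inj₂ (Iz , _)) = inj₁ Iz

  fundamentalCircuit-isCircuit : Indep I → ¬ Indep (I +ₛ x) → Circuit X (fundamentalCircuit I x)
  fundamentalCircuit-isCircuit {I} {x} iI dep =
    minimal-by-deletions (λ iJ I⊆J → indep-⊆ _ _ iJ I⊆J) dependent deletion-indep
    where
      deletion-indep : ∀ {z} → fundamentalCircuit I x z → Indep (fundamentalCircuit I x -ₛ z)
      deletion-indep (inj₁ refl) = indep-⊆ _ I iI λ where
        (inj₁ w≡x , w≢x) → ⊥-elim (w≢x w≡x)
        (inj₂ (Iw , _) , _) → Iw
      deletion-indep (inj₂ (_ , iI-z+x)) = indep-⊆ _ _ iI-z+x λ where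
        (inj₁ w≡x , _) → inj₂ w≡x
        (inj₂ (Iw , _) , w≢z) → inj₁ (Iw , w≢z)
      I∋y : ∀ {y K} → (I +ₛ x) y → ¬ K y → fundamentalCircuit I x ⊆ K → I y
      I∋y (inj₁ Iy) _ _ = Iy
      I∋y (inj₂ refl) ¬Ky C⊆K = ⊥-elim (¬Ky (C⊆K (inj₁ refl)))
      no-augmentation : ∀ {y K} → fundamentalCircuit I x ⊆ K → K ⊆ I +ₛ x → ¬ K y → I y →
                        ¬ Σ E (λ z → K z × ¬ (I -ₛ y) z × Indep ((I -ₛ y) +ₛ z))
      no-augmentation {y} C⊆K K⊆I+x ¬Ky Iy (z , Kz , ¬I-y-z , iI-y+z) with K⊆I+x Kz | dec (z ≡ y)
      ... | inj₂ refl | _ = ¬Ky (C⊆K (inj₂ (Iy , iI-y+z)))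
      ... | inj₁ Iz | no z≢y = ¬I-y-z (Iz , z≢y)
      ... | inj₁ _ | yes refl = ¬Ky Kz
      -- A maximal independent K with C ⊆ K ⊆ I + x misses some y ∈ I; augmenting I - y from K inside
      -- I + x can only add x, which would put y into C.
      dependent : ¬ Indep (fundamentalCircuit I x)
      dependent iC
        with K , C⊆K , maxK@((_ , K⊆I+x) , _) ← extend-to-maxIndepIn iC fundamentalCircuit-⊆
        with y , I+x∋y , ¬Ky , _ ← maxIndepIn-dependent maxK dep
        with Iy ← I∋y I+x∋y ¬Ky C⊆K
        = no-augmentation C⊆K K⊆I+x ¬Ky Iy
            (restriction-augment {I = I -ₛ y} maxK (indep-⊆ _ I iI proj₁) (λ I-y-w → inj₁ (proj₁ I-y-w))
               I+x∋y (λ I-y-y → proj₂ I-y-y refl) (indep-⊆ _ I iI (+ₛ-⊆ {X = I -ₛ y} proj₁ Iy)))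

  circuit⊆fundamentalCircuit : Indep I → Circuit X C → C ⊆ I +ₛ x → C ⊆ fundamentalCircuit I x
  circuit⊆fundamentalCircuit {I} {C} {x} iI circC@(dC , _) C⊆I+x =
    proj₂ circC _ (proj₁ (fundamentalCircuit-isCircuit iI λ iI+x → dC (indep-⊆ _ _ iI+x C⊆I+x))) fundamentalCircuit⊆C
    where
      C⊆I-z+x : ∀ {z} → ¬ C z → C ⊆ (I -ₛ z) +ₛ x
      C⊆I-z+x ¬Cz {w} Cw with C⊆I+x Cw
      ... | inj₁ Iw = inj₁ (Iw , λ { refl → ¬Cz Cw })
      ... | inj₂ w≡x = inj₂ w≡x
      C⊆I : ¬ C x → C ⊆ I
      C⊆I ¬Cx Cw with C⊆I+x Cw
      ... | inj₁ Iw = Iw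
      ... | inj₂ refl = ⊥-elim (¬Cx Cw)
      fundamentalCircuit⊆C : fundamentalCircuit I x ⊆ C
      fundamentalCircuit⊆C (inj₁ refl) = dne λ ¬Cx → dC (indep-⊆ _ _ iI (C⊆I ¬Cx))
      fundamentalCircuit⊆C (inj₂ (_ , iI-z+x)) = dne λ ¬Cz → dC (indep-⊆ _ _ iI-z+x (C⊆I-z+x ¬Cz))

  circuit-deletion-indep : Circuit X C → C x → Indep (C -ₛ x)
  circuit-deletion-indep (_ , minC) Cx = dne λ dep → proj₂ (minC _ dep proj₁ Cx) refl

  dependent-contains-circuit : ¬ Indep Y → Σ (Subset E) λ C → Circuit X C × C ⊆ Y
  dependent-contains-circuit {Y} ¬iY
    with J , maxJ@((iJ , J⊆Y) , _) ← maxIndepIn-exists Y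
    with x , Yx , _ , dep ← maxIndepIn-dependent maxJ ¬iY
    = _ , fundamentalCircuit-isCircuit iJ dep , λ Cz → +ₛ-⊆ J⊆Y Yx (fundamentalCircuit-⊆ Cz)

  dependent-extension⇒cl : Indep I → ¬ Indep (I +ₛ x) → cl X I x
  dependent-extension⇒cl iI dep = inj₂ (_ , fundamentalCircuit-isCircuit iI dep , inj₁ refl , fundamentalCircuit-⊆)

  base-spans : Base X P → cl X P x
  base-spans {P} {x} bP with dec (P x)
  ... | yes Px = inj₁ Px
  ... | no ¬Px = dependent-extension⇒cl (proj₁ bP) (base-+-dependent bP ¬Px)

  cl⇒+-dependent : cl X I x → ¬ I x → ¬ Indep (I +ₛ x)
  cl⇒+-dependent (inj₁ Ix) ¬Ix = ⊥-elim (¬Ix Ix)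
  cl⇒+-dependent (inj₂ (_ , (dC , _) , _ , C⊆I+x)) _ iI+x = dC (indep-⊆ _ _ iI+x C⊆I+x)

  -- The circuit through b in K + b gives a maximal independent J ⊆ K with J + b dependent, i.e. J is
  -- maximal in K + b; then L, which can be augmented by b, can be augmented from J inside K.
  maxIndepIn-spans : MaxIndepIn K L → cl X K b → ¬ L b → ¬ Indep (L +ₛ b)
  maxIndepIn-spans maxL (inj₁ Kb) ¬Lb iL+b = maxIndepIn-+-dependent maxL Kb ¬Lb iL+b
  maxIndepIn-spans {K} {L} {b} maxL@((iL , L⊆K) , _) (inj₂ (C , circC , Cb , C⊆K+b)) ¬Lb iL+b
    = let J , C-b⊆J , maxJ@((_ , J⊆K) , _) =
            extend-to-maxIndepIn (circuit-deletion-indep circC Cb) (⊆+⇒-⊆ {X = C} {x = b} C⊆K+b)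
          J+b-dependent = λ iJ+b → proj₁ circC (indep-⊆ C _ iJ+b (-⊆⇒⊆+ {X = C} {b = b} C-b⊆J))
          z , Jz , ¬Lz , iL+z =
            restriction-augment (maxIndepIn-+ maxJ J+b-dependent) iL (λ Lw → inj₁ (L⊆K Lw)) (inj₂ refl) ¬Lb iL+b
      in maxIndepIn-+-dependent maxL (J⊆K Jz) ¬Lz iL+z

  cl-exchange-indep : Indep Q → Q b → ¬ Q e → cl X ((Q -ₛ b) +ₛ e) b → Indep ((Q -ₛ b) +ₛ e)
  cl-exchange-indep _ _ _ (inj₁ (inj₁ (_ , b≢b))) = ⊥-elim (b≢b refl)
  cl-exchange-indep _ Qb ¬Qe (inj₁ (inj₂ refl)) = ⊥-elim (¬Qe Qb)
  cl-exchange-indep {Q} {b} {e} iQ Qb ¬Qe (inj₂ (C , circC , Cb , C⊆Q'+b))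
    = [ (λ { refl → ⊥-elim (¬Qe Qb) }) , proj₂ ]
        (circuit⊆fundamentalCircuit {I = Q} {C = C} {x = e} iQ circC
           (λ Cw → exchange-+-⊆ {X = Q} {e = e} Qb (C⊆Q'+b Cw)) Cb)

  fundamentalCocircuit : Subset E → E → Subset E
  fundamentalCocircuit K e f = ¬ (K -ₛ e) f × Indep ((K -ₛ e) +ₛ f)

  fundamentalCocircuit-isCocircuit : Base X K → K e → CoCircuit X (fundamentalCocircuit K e)
  fundamentalCocircuit-isCocircuit {K} {e} bK Ke = minimal-by-deletions coindep-⊆ not-coindep deletion-coindep
    where
      coindep-⊆ : ∀ {I J} → CoIndep X J → I ⊆ J → CoIndep X I
      coindep-⊆ (B , bB , J∩B≡∅) I⊆J = B , bB , λ x Ix → J∩B≡∅ x (I⊆J Ix)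
      not-coindep : ¬ CoIndep X (fundamentalCocircuit K e)
      not-coindep (B , bB , D∩B≡∅)
        with z , Bz , ¬K-e-z , iK-e+z ←
               indep-aug (K -ₛ e) B (indep-⊆ _ K (proj₁ bK) proj₁) (base-minus-not-base bK Ke) bB
        = D∩B≡∅ z (¬K-e-z , iK-e+z) Bz
      deletion-coindep : ∀ {d} → fundamentalCocircuit K e d → CoIndep X (fundamentalCocircuit K e -ₛ d)
      deletion-coindep (¬K-e-d , iK-e+d) = _ , exchange-preserves-base bK Ke ¬K-e-d iK-e+d , λ where
        w ((¬K-e-w , _) , _) (inj₁ K-e-w) → ¬K-e-w K-e-w
        w (_ , w≢d) (inj₂ w≡d) → w≢d w≡d

  fundamentalCocircuit-disjoint : L ⊆ K → ¬ L e → L ⊆ ∁ (fundamentalCocircuit K e)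
  fundamentalCocircuit-disjoint L⊆K ¬Le Lf (¬K-e-f , _) = ¬K-e-f (L⊆K Lf , λ { refl → ¬Le Lf })

module BaseTransfer (em : ExcludedMiddle (Level.suc 0ℓ)) {E : Set} (X Y : Matroid E) where
  open Classical em
  private
    module X = MatroidTheory em X
    module Y = MatroidTheory em Y
    variable
      P Q K : Subset E
      b e : E

  ExchangeClosed : Set₁
  ExchangeClosed = ∀ {Q b e} → Base X Q → Base Y Q → Q b → ¬ Q e →
                   Base X ((Q -ₛ b) +ₛ e) → Base Y ((Q -ₛ b) +ₛ e)

  module _ (closed : ExchangeClosed) where

    exchange-⇔ : Base X Q → Q b → ¬ Q e → Base X ((Q -ₛ b) +ₛ e) → Base Y Q ⇔ Base Y ((Q -ₛ b) +ₛ e)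
    exchange-⇔ {Q} {b} {e} bXQ Qb ¬Qe bXQ' = mk⇔ (λ bYQ → closed bXQ bYQ Qb ¬Qe bXQ') backwards
      where
        Q≐Q'-e+b = exchange-inverse Qb ¬Qe
        ¬Q'b : ¬ ((Q -ₛ b) +ₛ e) b
        ¬Q'b (inj₁ (_ , b≢b)) = b≢b refl
        ¬Q'b (inj₂ refl) = ¬Qe Qb
        backwards : Base Y ((Q -ₛ b) +ₛ e) → Base Y Q
        backwards bYQ' = Y.base-respects-≐
          (closed bXQ' bYQ' (inj₂ refl) ¬Q'b (X.base-respects-≐ bXQ (≐-sym Q≐Q'-e+b)))
          Q≐Q'-e+b

    finite-difference-⇔ : Base X P → Base X K → (xs : List E) → (∀ x → (P ∖ K) x → x ∈ xs) →
                          Base Y P ⇔ Base Y K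
    finite-difference-⇔ {P} {K} bP bK [] cover =
      mk⇔ (λ bYP → Y.base-respects-≐ bYP P≐K) (λ bYK → Y.base-respects-≐ bYK (≐-sym P≐K))
      where
        P⊆K : P ⊆ K
        P⊆K {x} Px = dne λ ¬Kx → ¬Any[] (cover x (Px , ¬Kx))
        P≐K : P ≐ K
        P≐K = P⊆K , proj₂ bP K (proj₁ bK) P⊆K
    finite-difference-⇔ {P} {K} bP bK (y ∷ ys) cover with dec ((P ∖ K) y)
    ... | no y∉P∖K = finite-difference-⇔ bP bK ys cover'
      where
        cover' : ∀ x → (P ∖ K) x → x ∈ ys
        cover' x x∈P∖K with cover x x∈P∖K
        ... | here refl = ⊥-elim (y∉P∖K x∈P∖K)
        ... | there x∈ys = x∈ys
    ... | yes (Py , ¬Ky) with b , Kb , ¬Pb , bP' ← X.base-exchange bP bK Py ¬Ky =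
      finite-difference-⇔ bP' bK ys cover' ⇔-∘ exchange-⇔ bP Py ¬Pb bP'
      where
        cover' : ∀ x → ((P -ₛ y) +ₛ b ∖ K) x → x ∈ ys
        cover' x (inj₁ (Px , x≢y) , ¬Kx) with cover x (Px , ¬Kx)
        ... | here x≡y = ⊥-elim (x≢y x≡y)
        ... | there x∈ys = x∈ys
        cover' x (inj₂ refl , ¬Kx) = ⊥-elim (¬Kx Kb)

module QuotientTheory (em : ExcludedMiddle (Level.suc 0ℓ)) {E : Set} (M N : Matroid E) (quotient : IsQuotient N M) where
  open Classical em
  private
    module M = MatroidTheory em M
    module N = MatroidTheory em N
    module M→N = BaseTransfer em M N
    module N→M = BaseTransfer em N M
    variable
      I K L : Subset E

  N-indep⇒M-indep : N.Indep I → M.Indep I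
  N-indep⇒M-indep {I} iNI = dne λ ¬iMI →
    let J , maxJ@((iJ , J⊆I) , _) = M.maxIndepIn-exists I
        x , Ix , ¬Jx , dep = M.maxIndepIn-dependent maxJ ¬iMI
    in N.cl⇒+-dependent (quotient J (M.dependent-extension⇒cl iJ dep)) ¬Jx (N.indep-⊆ _ I iNI (+ₛ-⊆ J⊆I Ix))

  N-maxIndepIn-M-base⇒N-base : Base M K → N.MaxIndepIn K L → Base N L
  N-maxIndepIn-M-base⇒N-base {K} {L} bMK maxL@((iL , _) , _) = dne₁ λ ¬bNL →
    let B , bNB = N.base-exists
        b , _ , ¬Lb , iL+b = N.indep-aug L B iL ¬bNL bNB
    in N.maxIndepIn-spans maxL (quotient K (M.base-spans bMK)) ¬Lb iL+b

  M-exchange-preserves-N-base : M→N.ExchangeClosed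
  M-exchange-preserves-N-base bMQ bNQ Qb ¬Qe bMQ' =
    N.exchange-preserves-base bNQ Qb (λ Q-b-e → ¬Qe (proj₁ Q-b-e))
      (N.cl-exchange-indep (proj₁ bNQ) Qb ¬Qe (quotient _ (M.base-spans bMQ')))

  N-exchange-preserves-M-base : N→M.ExchangeClosed
  N-exchange-preserves-M-base bNQ bMQ Qb ¬Qe bNQ' =
    M.exchange-preserves-base bMQ Qb (λ Q-b-e → ¬Qe (proj₁ Q-b-e)) (N-indep⇒M-indep (proj₁ bNQ'))

  module _ {B : Subset E} (bMB : Base M B) (bNB : Base N B) where

    finitary⇒M-indep⇒N-indep : Finitary N → M.Indep I → N.Indep I
    finitary⇒M-indep⇒N-indep finitary iMI = dne λ ¬iNI →
      let C , circC , C⊆I = N.dependent-contains-circuit ¬iNI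
          K , bMK , C⊆K , K⊆C∪B = M.extend-to-base-within (M.indep-⊆ _ _ iMI C⊆I) bMB
          xs , cover = finite-⊆ {X = K ∖ B} (⊆∪⇒∖⊆ {Y = C} {Z = B} K⊆C∪B) (finitary C circC)
          bNK = Equivalence.from (M→N.finite-difference-⇔ M-exchange-preserves-N-base bMK bMB xs cover) bNB
      in proj₁ circC (N.indep-⊆ _ K (proj₁ bNK) C⊆K)

    finite-M-cocircuit-meets-N-base : {D : Subset E} → CoCircuit M D → Finite D → Base N L → ¬ L ⊆ ∁ D
    finite-M-cocircuit-meets-N-base {D = D} (¬coindep , _) (xs , cover) bNL L⊆∁D =
      let J , B∖D⊆J , maxJ = N.extend-to-maxIndepIn {Y = ∁ D} (N.indep-⊆ _ B (proj₁ bNB) proj₁) proj₂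
          bNJ = N.spanning-maxIndepIn⇒base bNL L⊆∁D maxJ
          bMJ = Equivalence.to (N→M.finite-difference-⇔ N-exchange-preserves-M-base bNB bNJ xs
                                  λ x B∖J∋x → cover x (∖-⊆-swap {X = B} {Y = D} B∖D⊆J B∖J∋x)) bMB
      in ¬coindep (J , bMJ , λ x Dx Jx → proj₂ (proj₁ maxJ) Jx Dx)

    cofinitary⇒N-base⇒M-base : Cofinitary M → Base N L → Base M L
    cofinitary⇒N-base⇒M-base {L} cofinitary bNL = dne₁ λ ¬bML →
      let K , bMK , L⊆K , _ = M.extend-to-base-within (N-indep⇒M-indep (proj₁ bNL)) bMB
          e , Ke , ¬Le = ⊈⇒∃ {X = K} {Y = L} (λ K⊆L → ¬bML (M.base-respects-≐ bMK (K⊆L , L⊆K)))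
          coD = M.fundamentalCocircuit-isCocircuit bMK Ke
      in finite-M-cocircuit-meets-N-base coD (cofinitary _ coD) bNL (M.fundamentalCocircuit-disjoint L⊆K ¬Le)

    cofinitary⇒M-indep⇒N-indep : Cofinitary M → M.Indep I → N.Indep I
    cofinitary⇒M-indep⇒N-indep cofinitary iMI =
      let K , bMK , I⊆K , _ = M.extend-to-base-within iMI bMB
          L , maxL@((iNL , L⊆K) , _) = N.maxIndepIn-exists K
          bML = cofinitary⇒N-base⇒M-base cofinitary (N-maxIndepIn-M-base⇒N-base bMK maxL)
      in N.indep-⊆ _ L iNL λ Iz → proj₂ bML K (proj₁ bMK) L⊆K (I⊆K Iz)

mainTheorem6 : ExcludedMiddle (Level.suc 0ℓ) →
    {E : Set} (M N : Matroid E) →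
    IsQuotient N M →
    Σ (Subset E) (λ B → Base M B × Base N B) →
    Finitary N ⊎ Cofinitary M →
    SameMatroid M N
mainTheorem6 em M N quotient (B , bMB , bNB) finiteness I =
  [ finitary⇒M-indep⇒N-indep bMB bNB , cofinitary⇒M-indep⇒N-indep bMB bNB ] finiteness , N-indep⇒M-indep
  where open QuotientTheory em M N quotient
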